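{- Let $(N,\mathcal{W})$ be a complete simple game without vetoers, with equivalence classes $N_1,\dots,N_t$ ordered by decreasing desirability, $n_j=|N_j|$, $\tilde n=(n_1,\dots,n_t)$, and shift-minimal winning vectors $\tilde m_1,\dots,\tilde m_r$. Let $o=(o_1,\dots,o_t)=\Sigma(\tilde n)$ and $p^i=(p^i_1,\dots,p^i_t)=\Sigma(\tilde m_i)$ for $1\le i\le r$. Then $\nu(N,\mathcal{W})$ equals the optimal value of the integer program $$\min\sum_{i=1}^r x_i\quad\text{s.t.}\quad \sum_{i=1}^r (o_j-p^i_j)\,x_i\ge o_j\ \ \forall 1\le j\le t,\qquad x_i\in\mathbb{Z}_{\ge0}\ \ \forall 1\le i\le r.$$
   Context: A simple game $(N,\mathcal{W})$: $N$ finite, $\mathcal{W}$ a family of subsets (winning coalitions) with $\emptyset\notin\mathcal{W}$, $N\in\mathcal{W}$, closed under supersets; a vetoer is a player in every winning coalition; the Nakamura number $\nu(N,\mathcal{W})$ is the minimum number of winning coalitions with empty intersection. Write $i\sqsupseteq j$ if for every $S$ with $j\in S\subseteq N\setminus\{i\}$, $S\in\mathcal{W}$ implies $(S\setminus\{j\})\cup\{i\}\in\mathcal{W}$. The game is complete if $\sqsupseteq$ is a total preorder; its equivalence classes $N_1,\dots,N_t$ are ordered so that $i\sqsupseteq j$ and not $j\sqsupseteq i$ whenever $i\in N_a$, $j\in N_b$, $a<b$. The coalition vector of $S$ is $(|S\cap N_1|,\dots,|S\cap N_t|)$; it is winning/losing according as $S$ is. For $u\in\mathbb{N}_{\ge0}^t$,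 $\Sigma(u)$ is the vector with $i$-th entry $\sum_{j=1}^i u_j$. For coalition vectors write $u\preceq v$ if $\Sigma(u)\le\Sigma(v)$ componentwise. A winning coalition vector $u$ is shift-minimal winning if every coalition vector $v\preceq u$ with $v\neq u$ is losing. -}

module Defs where

open import Data.Nat using (ℕ; _+_; _*_; _∸_; _≤_)
open import Data.Fin using (Fin; _≟_)
open import Data.Fin.Subset using (Subset; inside; outside; _∈_; _∉_; _⊆_; _∩_; ⋂; ∣_∣)
import Data.Fin.Subset as Sub
open import Data.Vec using (Vec; []; _∷_; tabulate; lookup; sum; _[_]≔_)
open import Data.Vec.Relation.Binary.Pointwise.Inductive using (Pointwise)
open import Data.List using (List; length)
open import Data.List.Relation.Unary.All using (All)
open import Data.Product using (Σ; ∃; _×_)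
open import Data.Sum using (_⊎_)
open import Relation.Binary.PropositionalEquality using (_≡_; _≢_)
open import Relation.Nullary using (¬_)
open import Relation.Nullary.Decidable using (⌊_⌋)

record SimpleGame (n : ℕ) : Set₁ where
  field
    W         : Subset n → Set
    ∅-losing  : ¬ W Sub.⊥
    N-winning : W Sub.⊤
    monotone  : ∀ {S T} → W S → S ⊆ T → W T
open SimpleGame public

prefixSums′ : ∀ {t} → ℕ → Vec ℕ t → Vec ℕ t
prefixSums′ acc []       = []
prefixSums′ acc (x ∷ xs) = (acc + x) ∷ prefixSums′ (acc + x) xs

prefixSums : ∀ {t} → Vec ℕ t → Vec ℕ t
prefixSums = prefixSums′ 0

_⪯_ : ∀ {t} → Vec ℕ t → Vec ℕ t → Set
u ⪯ v = Pointwise _≤_ (prefixSums u) (prefixSums v)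

module _ {n : ℕ} (G : SimpleGame n) where

  Vetoer : Fin n → Set
  Vetoer i = ∀ S → W G S → i ∈ S

  Desirable : Fin n → Fin n → Set
  Desirable i j = ∀ S → j ∈ S → i ∉ S → W G S → W G ((S [ j ]≔ outside) [ i ]≔ inside)

  IsComplete : Set
  IsComplete = (∀ i → Desirable i i)
             × (∀ i j k → Desirable i j → Desirable j k → Desirable i k)
             × (∀ i j → Desirable i j ⊎ Desirable j i)

  IsNakamuraNumber : ℕ → Set
  IsNakamuraNumber k =
      (∃ λ (Ss : List (Subset n)) → length Ss ≡ k × All (W G) Ss × ⋂ Ss ≡ Sub.⊥)
    × (∀ (Ss : List (Subset n)) → All (W G) Ss → ⋂ Ss ≡ Sub.⊥ → k ≤ length Ss)

  -- Given the equivalence classes N_1,…,N_t as a labelling cls : N → Fin t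
  module _ {t : ℕ} (cls : Fin n → Fin t) where

    classSet : Fin t → Subset n
    classSet a = tabulate (λ i → ⌊ cls i ≟ a ⌋)

    coalVec : Subset n → Vec ℕ t
    coalVec S = tabulate (λ a → ∣ S ∩ classSet a ∣)

    IsCoalitionVector : Vec ℕ t → Set
    IsCoalitionVector u = ∃ λ S → coalVec S ≡ u

    WinningVector : Vec ℕ t → Set
    WinningVector u = ∃ λ S → coalVec S ≡ u × W G S

    LosingVector : Vec ℕ t → Set
    LosingVector u = IsCoalitionVector u × (∀ S → coalVec S ≡ u → ¬ W G S)

    ShiftMinimalWinning : Vec ℕ t → Set
    ShiftMinimalWinning u =
      WinningVector u × (∀ v → IsCoalitionVector v → v ⪯ u → v ≢ u → LosingVector v)

    classSizes : Vec ℕ t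
    classSizes = coalVec Sub.⊤

-- The integer program with data o ∈ ℕ^t and p^1,…,p^r ∈ ℕ^t (with p^i ≤ o, so ∸ is exact):
--   min Σ_i x_i  s.t.  Σ_i (o_j − p^i_j) x_i ≥ o_j  for all j,  x ∈ ℤ_{≥0}^r
module _ {t r : ℕ} (o : Vec ℕ t) (p : Fin r → Vec ℕ t) where

  objective : (Fin r → ℕ) → ℕ
  objective x = sum (tabulate x)

  Feasible : (Fin r → ℕ) → Set
  Feasible x = ∀ (j : Fin t) →
    lookup o j ≤ sum (tabulate (λ i → (lookup o j ∸ lookup (p i) j) * x i))

  IsIPOptimalValue : ℕ → Set
  IsIPOptimalValue k =
      (∃ λ x → Feasible x × objective x ≡ k)
    × (∀ x → Feasible x → k ≤ objective x)

module Submission where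

-- Read o_j − p^i_j as the number of players of the first j classes missing from a coalition
-- T_i with vector m̃_i. Given winning coalitions with empty intersection, replace each by a
-- shift-minimal vector below it: every player of the first j classes is missing from some
-- coalition, which gives a feasible x whose sum is the number of coalitions. Conversely, given a
-- feasible x, take x_i copies of T_i. Feasibility is exactly the Hall-type condition that allows
-- a greedy assignment of the players, least desirable first, to the copies, so that copy l
-- receives at most as many players of the first j classes as T_l misses. Removing from N the
-- players assigned to l gives coalitions with empty intersection, and each is winning because its
-- prefix class counts dominate those of the winning T_l, and a player can always be traded for
-- one of a more desirable class.

open import Defs

open import Data.Nat.Properties hiding (_≟_)
open import Algebra.Properties.Semiring.Sum +-*-semiring
  using (sum-cong-≗; ∑-distrib-+; ∑-comm; *-distribˡ-sum; sum-remove; sum-replicate-zero)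
  renaming (sum to ∑)
open import Data.Bool using (Bool; true; false; _∧_; not)
open import Data.Bool.Properties using (T-≡; ∧-zeroʳ; ∧-identityʳ)
open import Data.Empty using (⊥-elim)
open import Data.Fin using (Fin; zero; suc; toℕ; _≟_; punchIn)
import Data.Fin as F
import Data.Fin.Properties as Finₚ
open import Data.Fin.Properties using (punchInᵢ≢i; any?)
open import Data.Fin.Subset using (Subset; inside; outside; _∩_; ⋂; ∣_∣)
import Data.Fin.Subset as Subset
open import Data.Fin.Subset.Properties using (Empty-unique)
open import Data.List using (List; []; _∷_; length) renaming (map to mapᴸ)
import Data.List as List
open import Data.List.Membership.Propositional using () renaming (_∈_ to _∈ᴸ_)
open import Data.List.Membership.Propositional.Properties using (∈-tabulate⁺)
open import Data.List.Properties using (length-tabulate)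
open import Data.List.Relation.Unary.All using (All; []; _∷_)
open import Data.List.Relation.Unary.All.Properties using (tabulate⁺)
open import Data.List.Relation.Unary.Any using (here; there)
open import Data.Nat using (ℕ; zero; suc; _+_; _*_; _∸_; _≤_; _<_; _≤ᵇ_; z≤n; s≤s; z<s; _<?_; _≤?_)
open import Data.Nat.Induction using (<-wellFounded)
open import Data.Nat.ListAction using () renaming (sum to sumᴸ)
open import Data.Product using (∃; _×_; _,_; proj₁; proj₂)
open import Data.Sum using (_⊎_; inj₁; inj₂; [_,_]′)
open import Data.Vec using (Vec; []; _∷_; tabulate; lookup; _[_]≔_)
import Data.Vec as Vec
open import Data.Vec.Functional using (updateAt)
open import Data.Vec.Functional.Properties using (updateAt-updates; updateAt-minimal)
open import Data.Vec.Properties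
  using (lookup-zipWith; lookup-replicate; lookup∘tabulate; ∷-injectiveˡ; ∷-injectiveʳ;
         lookup∘update; lookup∘update′; lookup⇒[]=; []=⇒lookup)
open import Data.Vec.Relation.Binary.Pointwise.Inductive as Pointwise using (Pointwise; []; _∷_)
open import Function using (_∘_; id; flip)
open import Function.Bundles using (_⇔_; Equivalence; mk⇔)
open import Function.Definitions using (Injective)
open import Induction.WellFounded using (Acc; acc)
open import Relation.Binary.Core using (Rel)
open import Relation.Binary.Definitions using (Total; Transitive)
open import Relation.Binary.PropositionalEquality
open import Relation.Nullary using (¬_; yes; no; Dec)
open import Relation.Nullary.Decidable using (⌊_⌋; does; dec-true; dec-false; isYes≗does)

true≢false : true ≢ false
true≢false ()

χ : Bool → ℕ
χ true  = 1
χ false = 0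

∑-mono-≤ : ∀ {n} {f g : Fin n → ℕ} → (∀ i → f i ≤ g i) → ∑ f ≤ ∑ g
∑-mono-≤ {zero}  f≤g = z≤n
∑-mono-≤ {suc n} f≤g = +-mono-≤ (f≤g zero) (∑-mono-≤ (f≤g ∘ suc))

∑-mono-< : ∀ {n} {f g : Fin n → ℕ} (a : Fin n) →
           (∀ i → f i ≤ g i) → f a < g a → ∑ f < ∑ g
∑-mono-< zero    f≤g fa<ga = +-mono-<-≤ fa<ga (∑-mono-≤ (f≤g ∘ suc))
∑-mono-< (suc a) f≤g fa<ga = +-mono-≤-< (f≤g zero) (∑-mono-< a (f≤g ∘ suc) fa<ga)

∑-<⇒∃< : ∀ {n} (f g : Fin n → ℕ) → ∑ f < ∑ g → ∃ λ i → f i < g i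
∑-<⇒∃< {zero}  f g ()
∑-<⇒∃< {suc n} f g ∑f<∑g with f zero <? g zero
... | yes f0<g0 = zero , f0<g0
... | no  f0≮g0 with ∑-<⇒∃< (f ∘ suc) (g ∘ suc) ∑f′<∑g′
  where
  ∑f′<∑g′ = +-cancelˡ-< (g zero) _ _ (≤-<-trans (+-monoˡ-≤ _ (≮⇒≥ f0≮g0)) ∑f<∑g)
...   | i , fi<gi = suc i , fi<gi

∑-update : ∀ {n} {f g : Fin n → ℕ} (a : Fin n) c →
           (∀ i → i ≢ a → f i ≡ g i) → f a ≡ g a + c → ∑ f ≡ ∑ g + c
∑-update {suc n} {f} {g} a c f≡g f[a] = begin
  ∑ f                            ≡⟨ sum-remove {i = a} f ⟩
  f a + ∑ (f ∘ punchIn a)        ≡⟨ cong₂ _+_ f[a] (sum-cong-≗ λ j → f≡g (punchIn a j) (punchInᵢ≢i a j)) ⟩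
  g a + c + ∑ (g ∘ punchIn a)    ≡⟨ +-assoc (g a) c _ ⟩
  g a + (c + ∑ (g ∘ punchIn a))  ≡⟨ cong (g a +_) (+-comm c _) ⟩
  g a + (∑ (g ∘ punchIn a) + c)  ≡⟨ +-assoc (g a) _ c ⟨
  g a + ∑ (g ∘ punchIn a) + c    ≡⟨ cong (_+ c) (sum-remove {i = a} g) ⟨
  ∑ g + c                        ∎
  where open ≡-Reasoning

∑-single : ∀ {n} {f : Fin n → ℕ} (a : Fin n) → (∀ i → i ≢ a → f i ≡ 0) → ∑ f ≡ f a
∑-single {n} a off = trans (∑-update a _ off refl) (cong (_+ _) (sum-replicate-zero n))

sum-tabulate : ∀ {n} (f : Fin n → ℕ) → Vec.sum (tabulate f) ≡ ∑ f
sum-tabulate {zero}  f = refl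
sum-tabulate {suc n} f = cong (f zero +_) (sum-tabulate (f ∘ suc))

∣S∣≡∑χ : ∀ {n} (S : Subset n) → ∣ S ∣ ≡ ∑ (χ ∘ lookup S)
∣S∣≡∑χ []          = refl
∣S∣≡∑χ (true  ∷ S) = cong suc (∣S∣≡∑χ S)
∣S∣≡∑χ (false ∷ S) = ∣S∣≡∑χ S

χ-≤1 : ∀ x → χ x ≤ 1
χ-≤1 true  = ≤-refl
χ-≤1 false = z≤n

χ-∧-≤ : ∀ x y → χ (x ∧ y) ≤ χ y
χ-∧-≤ true  y = ≤-refl
χ-∧-≤ false y = z≤n

χ-∧ : ∀ x y → χ (x ∧ y) ≡ χ x * χ y
χ-∧ true  y = sym (+-identityʳ (χ y))
χ-∧ false y = refl

δ : ∀ {k} → Fin k → Fin k → ℕ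
δ a b = χ (does (a ≟ b))

∑-δ : ∀ {k} (a : Fin k) → ∑ (δ a) ≡ 1
∑-δ a = trans (∑-single a λ l l≢a → cong χ (dec-false (a ≟ l) (l≢a ∘ sym)))
              (cong χ (dec-true (a ≟ a) refl))

∑-*-δ : ∀ {k} (c : Fin k → ℕ) (a : Fin k) → ∑ (λ i → c i * δ a i) ≡ c a
∑-*-δ c a = trans (∑-single a off) on
  where
  off : ∀ i → i ≢ a → c i * δ a i ≡ 0
  off i i≢a = trans (cong (λ b → c i * χ b) (dec-false (a ≟ i) (i≢a ∘ sym))) (*-zeroʳ (c i))
  on : c a * δ a a ≡ c a
  on = trans (cong (λ b → c a * χ b) (dec-true (a ≟ a) refl)) (*-identityʳ (c a))

module _ {a ℓ} {A : Set a} {_≲_ : Rel A ℓ}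
  (≲-total : Total _≲_) (≲-trans : Transitive _≲_) where

  private
    ≲-refl : ∀ {x} → x ≲ x
    ≲-refl {x} = [ id , id ]′ (≲-total x x)

  argmin : ∀ {n} (P : Fin n → Bool) (key : Fin n → A) →
    (∀ i → P i ≡ false) ⊎ (∃ λ y → P y ≡ true × (∀ i → P i ≡ true → key y ≲ key i))
  argmin {zero}  P key = inj₁ λ ()
  argmin {suc n} P key with argmin (P ∘ suc) (key ∘ suc) | P zero in P₀
  ... | inj₁ none | false = inj₁ λ { zero → P₀ ; (suc i) → none i }
  ... | inj₁ none | true  = inj₂ (zero , P₀ , λ
    { zero    _  → ≲-refl
    ; (suc i) Pi → ⊥-elim (true≢false (trans (sym Pi) (none i))) })
  ... | inj₂ (y , Py , y-min) | false = inj₂ (suc y , Py , λ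
    { zero    P₀′ → ⊥-elim (true≢false (trans (sym P₀′) P₀))
    ; (suc i) Pi  → y-min i Pi })
  ... | inj₂ (y , Py , y-min) | true with ≲-total (key zero) (key (suc y))
  ...   | inj₁ k₀≲ky = inj₂ (zero , P₀ , λ
    { zero    _  → ≲-refl
    ; (suc i) Pi → ≲-trans k₀≲ky (y-min i Pi) })
  ...   | inj₂ ky≲k₀ = inj₂ (suc y , Py , λ { zero _ → ky≲k₀ ; (suc i) Pi → y-min i Pi })

prepend : ∀ {A : Set} a {b} → A → (Fin b → A) → Fin (a + b) → A
prepend zero    v g l       = g l
prepend (suc a) v g zero    = v
prepend (suc a) v g (suc l) = prepend a v g l

∑-prepend : ∀ {A : Set} a {b} (c : A → ℕ) v (g : Fin b → A) →
            ∑ (c ∘ prepend a v g) ≡ a * c v + ∑ (c ∘ g)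
∑-prepend zero    c v g = refl
∑-prepend (suc a) c v g = trans (cong (c v +_) (∑-prepend a c v g)) (sym (+-assoc (c v) (a * c v) _))

blocks : ∀ {r} (x : Fin r → ℕ) → Fin (∑ x) → Fin r
blocks {suc r} x = prepend (x zero) zero (suc ∘ blocks (x ∘ suc))

∑-blocks : ∀ {r} (x c : Fin r → ℕ) → ∑ (c ∘ blocks x) ≡ ∑ (λ i → c i * x i)
∑-blocks {zero}  x c = refl
∑-blocks {suc r} x c = begin
  ∑ (c ∘ blocks x)
    ≡⟨ ∑-prepend (x zero) c zero (suc ∘ blocks (x ∘ suc)) ⟩
  x zero * c zero + ∑ (c ∘ suc ∘ blocks (x ∘ suc))
    ≡⟨ cong₂ _+_ (*-comm (x zero) (c zero)) (∑-blocks (x ∘ suc) (c ∘ suc)) ⟩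
  c zero * x zero + ∑ (λ i → c (suc i) * x (suc i))  ∎
  where open ≡-Reasoning

lookup-⋂ : ∀ {n} {S : Subset n} {Ss i} →
           S ∈ᴸ Ss → lookup S i ≡ false → lookup (⋂ Ss) i ≡ false
lookup-⋂ {S = S} {_ ∷ Ss} {i} (here refl) Si =
  trans (lookup-zipWith _∧_ i S (⋂ Ss)) (cong (_∧ lookup (⋂ Ss) i) Si)
lookup-⋂ {Ss = S′ ∷ Ss} {i} (there S∈Ss) Si =
  trans (lookup-zipWith _∧_ i S′ (⋂ Ss))
        (trans (cong (lookup S′ i ∧_) (lookup-⋂ S∈Ss Si)) (∧-zeroʳ (lookup S′ i)))

≤ᵇ-suc : ∀ m n → (suc m ≤ᵇ suc n) ≡ (m ≤ᵇ n)
≤ᵇ-suc zero    n = refl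
≤ᵇ-suc (suc m) n = refl

lookup-prefixSums′ : ∀ {t} base (g : Fin t → ℕ) (j : Fin t) →
  lookup (prefixSums′ base (tabulate g)) j ≡ base + ∑ (λ a → χ (toℕ a ≤ᵇ toℕ j) * g a)
lookup-prefixSums′ {suc t} base g zero = cong (base +_) (begin
  g zero                        ≡⟨ +-identityʳ (g zero) ⟨
  g zero + 0                    ≡⟨ cong₂ _+_ (+-identityʳ (g zero)) (sum-replicate-zero t) ⟨
  1 * g zero + ∑ {t} (λ _ → 0)  ∎)
  where open ≡-Reasoning
lookup-prefixSums′ {suc t} base g (suc j) = begin
  lookup (prefixSums′ (base + g zero) (tabulate (g ∘ suc))) j
    ≡⟨ lookup-prefixSums′ (base + g zero) (g ∘ suc) j ⟩
  base + g zero + ∑ (λ a → χ (toℕ a ≤ᵇ toℕ j) * g (suc a))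
    ≡⟨ +-assoc base (g zero) _ ⟩
  base + (g zero + ∑ (λ a → χ (toℕ a ≤ᵇ toℕ j) * g (suc a)))
    ≡⟨ cong₂ (λ x y → base + (x + y)) (+-identityʳ (g zero))
             (sum-cong-≗ λ a → cong (λ b → χ b * g (suc a)) (≤ᵇ-suc (toℕ a) (toℕ j))) ⟨
  base + (1 * g zero + ∑ (λ a → χ (suc (toℕ a) ≤ᵇ suc (toℕ j)) * g (suc a)))
    ∎
  where open ≡-Reasoning

lookup-prefixSums : ∀ {t} (g : Fin t → ℕ) (j : Fin t) →
  lookup (prefixSums (tabulate g)) j ≡ ∑ (λ a → χ (toℕ a ≤ᵇ toℕ j) * g a)
lookup-prefixSums = lookup-prefixSums′ 0

sum-mono-≤ : ∀ {t} {xs ys : Vec ℕ t} → Pointwise _≤_ xs ys → Vec.sum xs ≤ Vec.sum ys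
sum-mono-≤ []           = z≤n
sum-mono-≤ (x≤y ∷ xs≤ys) = +-mono-≤ x≤y (sum-mono-≤ xs≤ys)

Pointwise-≤∧sum-≡⇒≡ : ∀ {t} {xs ys : Vec ℕ t} →
                      Pointwise _≤_ xs ys → Vec.sum xs ≡ Vec.sum ys → xs ≡ ys
Pointwise-≤∧sum-≡⇒≡ [] _ = refl
Pointwise-≤∧sum-≡⇒≡ {xs = x ∷ xs} (x≤y ∷ xs≤ys) sum≡ with m≤n⇒m<n∨m≡n x≤y
... | inj₁ x<y  = ⊥-elim (<-irrefl sum≡ (+-mono-<-≤ x<y (sum-mono-≤ xs≤ys)))
... | inj₂ refl = cong (x ∷_) (Pointwise-≤∧sum-≡⇒≡ xs≤ys (+-cancelˡ-≡ x _ _ sum≡))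

prefixSums′-injective : ∀ {t} base → Injective _≡_ _≡_ (prefixSums′ {t} base)
prefixSums′-injective base {[]}    {[]}    _   = refl
prefixSums′-injective base {x ∷ u} {y ∷ v} eq with +-cancelˡ-≡ base x y (∷-injectiveˡ eq)
... | refl = cong (x ∷_) (prefixSums′-injective (base + x) (∷-injectiveʳ eq))

weight : ∀ {t} → Vec ℕ t → ℕ
weight v = Vec.sum (prefixSums v)

⪯∧≢⇒weight< : ∀ {t} {u v : Vec ℕ t} → v ⪯ u → v ≢ u → weight v < weight u
⪯∧≢⇒weight< {v = v} v⪯u v≢u with m≤n⇒m<n∨m≡n (sum-mono-≤ v⪯u)
... | inj₁ lt = lt
... | inj₂ eq = ⊥-elim (v≢u (prefixSums′-injective 0 (Pointwise-≤∧sum-≡⇒≡ v⪯u eq)))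

⪯-refl : ∀ {t} {u : Vec ℕ t} → u ⪯ u
⪯-refl = Pointwise.refl ≤-refl

⪯-trans : ∀ {t} {u v w : Vec ℕ t} → u ⪯ v → v ⪯ w → u ⪯ w
⪯-trans = Pointwise.trans ≤-trans

_⪯?_ : ∀ {t} (u v : Vec ℕ t) → Dec (u ⪯ v)
u ⪯? v = Pointwise.decidable _≤?_ (prefixSums u) (prefixSums v)

module Classes {n t : ℕ} (cls : Fin n → Fin t) where

  upTo : Fin t → Fin n → Bool
  upTo j i = toℕ (cls i) ≤ᵇ toℕ j

  countUpTo : (Fin n → Bool) → Fin t → ℕ
  countUpTo P j = ∑ λ i → χ (P i ∧ upTo j i)

  everyone : Fin n → Bool
  everyone _ = true

  upTo-complete : ∀ {i j} → cls i F.≤ j → upTo j i ≡ true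
  upTo-complete = Equivalence.to T-≡ ∘ ≤⇒≤ᵇ

  upTo-sound : ∀ {i j} → upTo j i ≡ true → cls i F.≤ j
  upTo-sound = ≤ᵇ⇒≤ _ _ ∘ Equivalence.from T-≡

  countUpTo-insert : ∀ {P Q : Fin n → Bool} {a j} → (∀ i → i ≢ a → P i ≡ Q i) →
    P a ≡ true → Q a ≡ false → upTo j a ≡ true → countUpTo P j ≡ countUpTo Q j + 1
  countUpTo-insert {P} {Q} {a} {j} P≡Q Pa Qa a≤j =
    ∑-update a 1 (λ i i≢a → cong (λ b → χ (b ∧ upTo j i)) (P≡Q i i≢a)) at-a
    where
    at-a : χ (P a ∧ upTo j a) ≡ χ (Q a ∧ upTo j a) + 1
    at-a rewrite Pa | Qa | a≤j = refl

  countUpTo-mono : ∀ P {j j′} → j F.≤ j′ → countUpTo P j ≤ countUpTo P j′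
  countUpTo-mono P {j} {j′} j≤j′ = ∑-mono-≤ λ i → grow i (P i) (upTo j i) refl
    where
    grow : ∀ i b u → upTo j i ≡ u → χ (b ∧ u) ≤ χ (b ∧ upTo j′ i)
    grow i false u     _   = z≤n
    grow i true  false _   = z≤n
    grow i true  true  i≤j rewrite upTo-complete {i} (Finₚ.≤-trans (upTo-sound i≤j) j≤j′) = ≤-refl

  countUpTo-complement : ∀ P j → countUpTo everyone j ≡ countUpTo P j + countUpTo (not ∘ P) j
  countUpTo-complement P j =
    trans (sum-cong-≗ λ i → split (P i) (upTo j i))
          (∑-distrib-+ (λ i → χ (P i ∧ upTo j i)) (λ i → χ (not (P i) ∧ upTo j i)))
    where
    split : ∀ b u → χ u ≡ χ (b ∧ u) + χ (not b ∧ u)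
    split true  u = sym (+-identityʳ (χ u))
    split false u = refl

  missingUpTo : Subset n → Fin t → ℕ
  missingUpTo S = countUpTo (not ∘ lookup S)

  totalMissingUpTo : List (Subset n) → Fin t → ℕ
  totalMissingUpTo Ss j = sumᴸ (mapᴸ (λ S → missingUpTo S j) Ss)

  missingUpTo-⋂ : ∀ Ss j → missingUpTo (⋂ Ss) j ≤ totalMissingUpTo Ss j
  missingUpTo-⋂ []       j = ≤-reflexive (trans (sum-cong-≗ none-missing) (sum-replicate-zero n))
    where
    none-missing : ∀ i → χ (not (lookup Subset.⊤ i) ∧ upTo j i) ≡ 0
    none-missing i = cong (λ b → χ (not b ∧ upTo j i)) (lookup-replicate i true)
  missingUpTo-⋂ (S ∷ Ss) j = begin
    missingUpTo (S ∩ ⋂ Ss) j                                  ≤⟨ ∑-mono-≤ subadditive ⟩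
    ∑ (λ i → missingˢ i + missingᴿ i)                         ≡⟨ ∑-distrib-+ missingˢ missingᴿ ⟩
    missingUpTo S j + missingUpTo (⋂ Ss) j                    ≤⟨ +-monoʳ-≤ _ (missingUpTo-⋂ Ss j) ⟩
    missingUpTo S j + totalMissingUpTo Ss j                   ∎
    where
    open ≤-Reasoning
    missingˢ missingᴿ : Fin n → ℕ
    missingˢ i = χ (not (lookup S i) ∧ upTo j i)
    missingᴿ i = χ (not (lookup (⋂ Ss) i) ∧ upTo j i)
    ∨-bound : ∀ a b u → χ (not (a ∧ b) ∧ u) ≤ χ (not a ∧ u) + χ (not b ∧ u)
    ∨-bound true  b u     = ≤-refl
    ∨-bound false b true  = s≤s z≤n
    ∨-bound false b false = z≤n
    subadditive : ∀ i → χ (not (lookup (S ∩ ⋂ Ss) i) ∧ upTo j i) ≤ missingˢ i + missingᴿ i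
    subadditive i rewrite lookup-zipWith _∧_ i S (⋂ Ss) =
      ∨-bound (lookup S i) (lookup (⋂ Ss) i) (upTo j i)

  prefixSums-coalVec : ∀ (G : SimpleGame n) S j →
    lookup (prefixSums (coalVec G cls S)) j ≡ countUpTo (lookup S) j
  prefixSums-coalVec G S j = begin
    lookup (prefixSums (coalVec G cls S)) j
      ≡⟨ lookup-prefixSums _ j ⟩
    ∑ (λ a → below a * ∣ S ∩ classSet G cls a ∣)
      ≡⟨ sum-cong-≗ (λ a → cong (below a *_) (∣S∣≡∑χ (S ∩ classSet G cls a))) ⟩
    ∑ (λ a → below a * ∑ (χ ∘ lookup (S ∩ classSet G cls a)))
      ≡⟨ sum-cong-≗ (λ a → cong (below a *_) (sum-cong-≗ (member a))) ⟩
    ∑ (λ a → below a * ∑ (λ i → inClass a i))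
      ≡⟨ sum-cong-≗ (λ a → *-distribˡ-sum (below a) (inClass a)) ⟩
    ∑ (λ a → ∑ (λ i → below a * inClass a i))
      ≡⟨ ∑-comm (λ a i → below a * inClass a i) ⟩
    ∑ (λ i → ∑ (λ a → below a * inClass a i))
      ≡⟨ sum-cong-≗ collapse ⟩
    countUpTo (lookup S) j
      ∎
    where
    open ≡-Reasoning
    below : Fin t → ℕ
    below a = χ (toℕ a ≤ᵇ toℕ j)
    inClass : Fin t → Fin n → ℕ
    inClass a i = χ (lookup S i ∧ ⌊ cls i ≟ a ⌋)
    member : ∀ a i → χ (lookup (S ∩ classSet G cls a) i) ≡ inClass a i
    member a i = cong χ (trans (lookup-zipWith _∧_ i S _) (cong (lookup S i ∧_) (lookup∘tabulate _ i)))
    collapse : ∀ i → ∑ (λ a → below a * inClass a i) ≡ χ (lookup S i ∧ upTo j i)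
    collapse i = begin
      ∑ (λ a → below a * inClass a i)        ≡⟨ sum-cong-≗ split ⟩
      ∑ (λ a → below a * χ b * δ (cls i) a)  ≡⟨ ∑-*-δ (λ a → below a * χ b) (cls i) ⟩
      χ (upTo j i) * χ b                     ≡⟨ *-comm (χ (upTo j i)) (χ b) ⟩
      χ b * χ (upTo j i)                     ≡⟨ χ-∧ b (upTo j i) ⟨
      χ (b ∧ upTo j i)                       ∎
      where
      b = lookup S i
      split : ∀ a → below a * inClass a i ≡ below a * χ b * δ (cls i) a
      split a = begin
        below a * χ (b ∧ ⌊ cls i ≟ a ⌋)     ≡⟨ cong (λ d → below a * χ (b ∧ d)) (isYes≗does (cls i ≟ a)) ⟩
        below a * χ (b ∧ does (cls i ≟ a))  ≡⟨ cong (below a *_) (χ-∧ b (does (cls i ≟ a))) ⟩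
        below a * (χ b * δ (cls i) a)       ≡⟨ *-assoc (below a) (χ b) _ ⟨
        below a * χ b * δ (cls i) a         ∎

module ShiftMinimal {n t r : ℕ} (G : SimpleGame n) (cls : Fin n → Fin t) (m : Fin r → Vec ℕ t)
  (m-shiftMinimal : ∀ u → ShiftMinimalWinning G cls u ⇔ (∃ λ i → m i ≡ u)) where

  -- A winning S with no m i below its vector would make that vector shift-minimal, unless a
  -- coalition with strictly ⪯-smaller vector wins; the weight strictly decreases along ⪯.
  private
    noneBelow⇒losing : ∀ S → Acc _<_ (weight (coalVec G cls S)) →
                       (∀ i → ¬ m i ⪯ coalVec G cls S) → ¬ W G S
    noneBelow⇒losing S (acc smaller) none S-winning = none i (subst (m i ⪯_) mi≡u ⪯-refl)
      where
      u = coalVec G cls S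
      u-shiftMinimal : ShiftMinimalWinning G cls u
      u-shiftMinimal = (S , refl , S-winning) , λ v v-coalition v⪯u v≢u → v-coalition , λ T T↦v →
        let T⪯u = subst (_⪯ u) (sym T↦v) v⪯u
        in noneBelow⇒losing T (smaller (⪯∧≢⇒weight< T⪯u (v≢u ∘ trans (sym T↦v))))
                              (λ i mi⪯T → none i (⪯-trans mi⪯T T⪯u))
      i = proj₁ (Equivalence.to (m-shiftMinimal u) u-shiftMinimal)
      mi≡u = proj₂ (Equivalence.to (m-shiftMinimal u) u-shiftMinimal)

  winning⇒shiftMinimalBelow : ∀ S → W G S → ∃ λ i → m i ⪯ coalVec G cls S
  winning⇒shiftMinimalBelow S w with any? (λ i → m i ⪯? coalVec G cls S)
  ... | yes found = found
  ... | no  none  = ⊥-elim (noneBelow⇒losing S (<-wellFounded _) (λ i mi⪯S → none (i , mi⪯S)) w)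

module Shift {n t : ℕ} (G : SimpleGame n) (cls : Fin n → Fin t)
  (desirable : ∀ i j → cls i F.≤ cls j → Desirable G i j) where
  open Classes cls

  _≼_ : Subset n → Subset n → Set
  T ≼ S = ∀ j → countUpTo (lookup T) j ≤ countUpTo (lookup S) j

  surplus : Subset n → Subset n → Fin n → Bool
  surplus T S i = lookup T i ∧ not (lookup S i)

  private
    ∧-not-true : ∀ a b → a ∧ not b ≡ true → a ≡ true × b ≡ false
    ∧-not-true true false _ = refl , refl

    -- y is a player of T ∖ S in the most desirable class. Counting at level cls y yields some
    -- x ∈ S ∖ T with cls x ≤ cls y; trading y for x keeps T winning and T ≼ S, and shrinks T ∖ S.
    module Exchange {T S : Subset n} (T≼S : T ≼ S) (y : Fin n) (y-surplus : surplus T S y ≡ true)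
      (y-least : ∀ i → surplus T S i ≡ true → cls y F.≤ cls i) where

      y∈T×y∉S : lookup T y ≡ true × lookup S y ≡ false
      y∈T×y∉S = ∧-not-true (lookup T y) (lookup S y) y-surplus

      y∈T = proj₁ y∈T×y∉S
      y∉S = proj₂ y∈T×y∉S

      partner : ∃ λ x → lookup T x ≡ false × lookup S x ≡ true × cls x F.≤ cls y
      partner = x , x∉T , x∈S , upTo-sound x≤y
        where
        inBoth inS : Fin n → ℕ
        inBoth i = χ (lookup S i ∧ (lookup T i ∧ upTo (cls y) i))
        inS i = χ (lookup S i ∧ upTo (cls y) i)
        inBoth<inT : ∑ inBoth < countUpTo (lookup T) (cls y)
        inBoth<inT = ∑-mono-< y (λ i → χ-∧-≤ (lookup S i) _) at-y
          where
          at-y : inBoth y < χ (lookup T y ∧ upTo (cls y) y)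
          at-y rewrite y∈T | y∉S | upTo-complete {y} {cls y} Finₚ.≤-refl = s≤s z≤n
        found = ∑-<⇒∃< inBoth inS (<-≤-trans inBoth<inT (T≼S (cls y)))
        x = proj₁ found
        onlyInS : ∀ s b u → χ (s ∧ (b ∧ u)) < χ (s ∧ u) →
                  b ≡ false × s ≡ true × u ≡ true
        onlyInS true  false true  _ = refl , refl , refl
        onlyInS true  true  true  (s≤s ())
        onlyInS true  b     false ()
        onlyInS false b     u     ()
        facts = onlyInS (lookup S x) (lookup T x) (upTo (cls y) x) (proj₂ found)
        x∉T = proj₁ facts
        x∈S = proj₁ (proj₂ facts)
        x≤y = proj₂ (proj₂ facts)

      x = proj₁ partner
      x∉T = proj₁ (proj₂ partner)
      x∈S = proj₁ (proj₂ (proj₂ partner))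
      x≤y = proj₂ (proj₂ (proj₂ partner))

      x≢y : x ≢ y
      x≢y x≡y = true≢false (trans (sym y∈T) (trans (cong (lookup T) (sym x≡y)) x∉T))

      T₁ T′ : Subset n
      T₁ = T [ y ]≔ outside
      T′ = T₁ [ x ]≔ inside

      T₁-y : lookup T₁ y ≡ false
      T₁-y = lookup∘update y T outside

      T₁-other : ∀ i → i ≢ y → lookup T₁ i ≡ lookup T i
      T₁-other i i≢y = lookup∘update′ i≢y T outside

      T′-x : lookup T′ x ≡ true
      T′-x = lookup∘update x T₁ inside

      T′-other : ∀ i → i ≢ x → lookup T′ i ≡ lookup T₁ i
      T′-other i i≢x = lookup∘update′ i≢x T₁ inside

      T′-y : lookup T′ y ≡ false
      T′-y = trans (T′-other y (x≢y ∘ sym)) T₁-y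

      T′-winning : W G T → W G T′
      T′-winning = desirable x y x≤y T (lookup⇒[]= y T y∈T)
                             (λ x∈T → true≢false (trans (sym ([]=⇒lookup x∈T)) x∉T))

      smallerSurplus : ∑ (χ ∘ surplus T′ S) < ∑ (χ ∘ surplus T S)
      smallerSurplus = ≤-<-trans (∑-mono-≤ T′≤T₁) (∑-mono-< y T₁≤T at-y)
        where
        T′≤T₁ : ∀ i → χ (surplus T′ S i) ≤ χ (surplus T₁ S i)
        T′≤T₁ i with i ≟ x
        ... | yes refl rewrite x∈S | ∧-zeroʳ (lookup T′ x) = z≤n
        ... | no  i≢x  rewrite T′-other i i≢x = ≤-refl
        T₁≤T : ∀ i → χ (surplus T₁ S i) ≤ χ (surplus T S i)
        T₁≤T i with i ≟ y
        ... | yes refl rewrite T₁-y = z≤n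
        ... | no  i≢y  rewrite T₁-other i i≢y = ≤-refl
        at-y : χ (surplus T₁ S y) < χ (surplus T S y)
        at-y rewrite T₁-y | y-surplus = s≤s z≤n

      below-y : ∀ {j} → upTo j y ≡ false →
                ∀ i → χ (lookup T i ∧ upTo j i) ≤ χ (lookup S i ∧ upTo j i)
      below-y {j} y≰j i with lookup T i in Ti | lookup S i in Si | upTo j i in i≤j
      ... | false | _     | _     = z≤n
      ... | true  | true  | _     = ≤-refl
      ... | true  | false | false = z≤n
      ... | true  | false | true  = ⊥-elim (true≢false (trans (sym y≤j) y≰j))
        where
        i-surplus : surplus T S i ≡ true
        i-surplus rewrite Ti | Si = refl
        y≤j = upTo-complete (Finₚ.≤-trans (y-least i i-surplus) (upTo-sound i≤j))

      T′≼S : T′ ≼ S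
      T′≼S j with upTo j y in y≤j
      ... | true = begin
        countUpTo (lookup T′) j  ≡⟨ trans T′-count (sym T-count) ⟩
        countUpTo (lookup T) j   ≤⟨ T≼S j ⟩
        countUpTo (lookup S) j   ∎
        where
        open ≤-Reasoning
        T-count : countUpTo (lookup T) j ≡ countUpTo (lookup T₁) j + 1
        T-count = countUpTo-insert (λ i i≢y → sym (T₁-other i i≢y)) y∈T T₁-y y≤j
        T′-count : countUpTo (lookup T′) j ≡ countUpTo (lookup T₁) j + 1
        T′-count = countUpTo-insert T′-other T′-x (trans (T₁-other x x≢y) x∉T)
                     (upTo-complete (Finₚ.≤-trans x≤y (upTo-sound y≤j)))
      ... | false = ∑-mono-≤ T′≤S
        where
        T′≤S : ∀ i → χ (lookup T′ i ∧ upTo j i) ≤ χ (lookup S i ∧ upTo j i)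
        T′≤S i with i ≟ x | i ≟ y
        ... | yes refl | _        rewrite T′-x | x∈S = ≤-refl
        ... | no  i≢x  | yes refl rewrite T′-y = z≤n
        ... | no  i≢x  | no  i≢y  rewrite T′-other i i≢x | T₁-other i i≢y = below-y y≤j i

  dominated⇒winning : ∀ {T S} → W G T → T ≼ S → W G S
  dominated⇒winning {T} {S} = go T (<-wellFounded _)
    where
    go : ∀ T → Acc _<_ (∑ (χ ∘ surplus T S)) → W G T → T ≼ S → W G S
    go T (acc smaller) T-winning T≼S with argmin Finₚ.≤-total Finₚ.≤-trans (surplus T S) cls
    ... | inj₁ none = monotone G T-winning (λ {i} i∈T → lookup⇒[]= i S (T⊆S i ([]=⇒lookup i∈T)))
      where
      T⊆S : ∀ i → lookup T i ≡ true → lookup S i ≡ true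
      T⊆S i Ti with lookup S i in Si | none i
      ... | true  | _ = refl
      ... | false | i-not-surplus =
        ⊥-elim (true≢false (trans (sym (trans (∧-identityʳ (lookup T i)) Ti)) i-not-surplus))
    ... | inj₂ (y , y-surplus , y-least) =
      go T′ (smaller smallerSurplus) (T′-winning T-winning) T′≼S
      where open Exchange {T} {S} T≼S y y-surplus y-least

module Assignment {n t K : ℕ} (cls : Fin n → Fin t) (cap : Fin K → Fin t → ℕ)
  (cap-mono : ∀ l {j j′} → j F.≤ j′ → cap l j ≤ cap l j′) (l₀ : Fin K) where
  open Classes cls

  load : (Fin n → Fin K) → (Fin n → Bool) → Fin K → Fin t → ℕ
  load f P l j = ∑ λ i → χ (P i ∧ upTo j i) * δ (f i) l

  ∑-load : ∀ f P j → ∑ (λ l → load f P l j) ≡ countUpTo P j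
  ∑-load f P j = begin
    ∑ (λ l → ∑ λ i → w i * δ (f i) l)  ≡⟨ ∑-comm (λ l i → w i * δ (f i) l) ⟩
    ∑ (λ i → ∑ λ l → w i * δ (f i) l)  ≡⟨ sum-cong-≗ (λ i → ∑-*-δ (λ _ → w i) (f i)) ⟩
    countUpTo P j                       ∎
    where
    open ≡-Reasoning
    w : Fin n → ℕ
    w i = χ (P i ∧ upTo j i)

  load-complement : ∀ f P l j →
    countUpTo P j ≡ countUpTo (λ i → P i ∧ not (does (f i ≟ l))) j + load f P l j
  load-complement f P l j =
    trans (sum-cong-≗ λ i → split (P i) (does (f i ≟ l)) (upTo j i))
          (∑-distrib-+ (λ i → χ ((P i ∧ not (does (f i ≟ l))) ∧ upTo j i))
                       (λ i → χ (P i ∧ upTo j i) * δ (f i) l))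
    where
    split : ∀ b d u → χ (b ∧ u) ≡ χ ((b ∧ not d) ∧ u) + χ (b ∧ u) * χ d
    split false d     u = refl
    split true  true  u = sym (*-identityʳ (χ u))
    split true  false u = sym (trans (cong (χ u +_) (*-zeroʳ (χ u))) (+-identityʳ (χ u)))

  Enough : (Fin n → Bool) → Set
  Enough P = ∀ j → countUpTo P j ≤ ∑ (λ l → cap l j)

  Fits : (Fin n → Bool) → (Fin n → Fin K) → Set
  Fits P f = ∀ l j → load f P l j ≤ cap l j

  -- The player q of P in the least desirable class is assigned last, to a coalition l* whose load
  -- at level cls q is below capacity. All of P lies at levels ≤ cls q, so this bound together
  -- with the monotonicity of cap covers every level j ≥ cls q.
  private
    module Extend {P : Fin n → Bool} (enough : Enough P) (q : Fin n) (q∈P : P q ≡ true)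
      (q-greatest : ∀ i → P i ≡ true → cls i F.≤ cls q) where

      P′ : Fin n → Bool
      P′ = updateAt P q (λ _ → false)

      P′-q : P′ q ≡ false
      P′-q = updateAt-updates q P

      P′-other : ∀ i → i ≢ q → P′ i ≡ P i
      P′-other i i≢q = updateAt-minimal i q P i≢q

      P′⊆P : ∀ i → P′ i ≡ true → P i ≡ true
      P′⊆P i P′i with i ≟ q
      ... | yes refl = ⊥-elim (true≢false (trans (sym P′i) P′-q))
      ... | no  i≢q  = trans (sym (P′-other i i≢q)) P′i

      fewer : ∑ (χ ∘ P′) < ∑ (χ ∘ P)
      fewer = begin-strict
        ∑ (χ ∘ P′)      <⟨ m<m+n _ z<s ⟩
        ∑ (χ ∘ P′) + 1  ≡⟨ ∑-update q 1 (λ i i≢q → cong χ (sym (P′-other i i≢q))) P-q ⟨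
        ∑ (χ ∘ P)       ∎
        where
        open ≤-Reasoning
        P-q : χ (P q) ≡ χ (P′ q) + 1
        P-q = trans (cong χ q∈P) (cong (λ b → χ b + 1) (sym P′-q))

      enough′ : Enough P′
      enough′ j = ≤-trans (∑-mono-≤ P′≤P) (enough j)
        where
        P′≤P : ∀ i → χ (P′ i ∧ upTo j i) ≤ χ (P i ∧ upTo j i)
        P′≤P i with i ≟ q
        ... | yes refl rewrite P′-q = z≤n
        ... | no  i≢q  rewrite P′-other i i≢q = ≤-refl

      module _ (f′ : Fin n → Fin K) (f′-fits : Fits P′ f′) where

        free : ∃ λ l → load f′ P′ l (cls q) < cap l (cls q)
        free = ∑-<⇒∃< (λ l → load f′ P′ l (cls q)) (λ l → cap l (cls q)) (begin-strict
          ∑ (λ l → load f′ P′ l (cls q))  ≡⟨ ∑-load f′ P′ (cls q) ⟩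
          countUpTo P′ (cls q)             <⟨ m<m+n _ z<s ⟩
          countUpTo P′ (cls q) + 1         ≡⟨ P-count ⟨
          countUpTo P (cls q)              ≤⟨ enough (cls q) ⟩
          ∑ (λ l → cap l (cls q))          ∎)
          where
          open ≤-Reasoning
          P-count = countUpTo-insert (λ i i≢q → sym (P′-other i i≢q)) q∈P P′-q
                                     (upTo-complete Finₚ.≤-refl)

        l* = proj₁ free

        f : Fin n → Fin K
        f = updateAt f′ q (λ _ → l*)

        load-f : ∀ l j → load f P l j ≡ load f′ P′ l j + χ (upTo j q) * δ l* l
        load-f l j = ∑-update q _ off at-q
          where
          off : ∀ i → i ≢ q → χ (P i ∧ upTo j i) * δ (f i) l ≡ χ (P′ i ∧ upTo j i) * δ (f′ i) l
          off i i≢q = cong₂ (λ b k → χ (b ∧ upTo j i) * δ k l)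
                            (sym (P′-other i i≢q)) (updateAt-minimal i q {λ _ → l*} f′ i≢q)
          at-q : χ (P q ∧ upTo j q) * δ (f q) l
               ≡ χ (P′ q ∧ upTo j q) * δ (f′ q) l + χ (upTo j q) * δ l* l
          at-q = begin
            χ (P q ∧ upTo j q) * δ (f q) l
              ≡⟨ cong₂ (λ b k → χ (b ∧ upTo j q) * δ k l) q∈P (updateAt-updates q {λ _ → l*} f′) ⟩
            χ (upTo j q) * δ l* l
              ≡⟨ cong (λ b → χ (b ∧ upTo j q) * δ (f′ q) l + χ (upTo j q) * δ l* l) P′-q ⟨
            χ (P′ q ∧ upTo j q) * δ (f′ q) l + χ (upTo j q) * δ l* l
              ∎
            where open ≡-Reasoning

        load-below-q : ∀ l j → load f′ P′ l j ≤ load f′ P′ l (cls q)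
        load-below-q l j = ∑-mono-≤ λ i → *-monoˡ-≤ (δ (f′ i) l) (below i)
          where
          below : ∀ i → χ (P′ i ∧ upTo j i) ≤ χ (P′ i ∧ upTo (cls q) i)
          below i with P′ i in P′i
          ... | false = z≤n
          ... | true rewrite upTo-complete (q-greatest i (P′⊆P i P′i)) = χ-≤1 (upTo j i)

        f-fits : Fits P f
        f-fits l j rewrite load-f l j = bound (upTo j q) refl (l* ≟ l)
          where
          bound : ∀ b → upTo j q ≡ b → (d : Dec (l* ≡ l)) →
                  load f′ P′ l j + χ b * χ (does d) ≤ cap l j
          bound false _   _          = subst (_≤ cap l j) (sym (+-identityʳ _)) (f′-fits l j)
          bound true  _   (no _)     = subst (_≤ cap l j) (sym (+-identityʳ _)) (f′-fits l j)
          bound true  q≤j (yes refl) = subst (_≤ cap l* j) (+-comm 1 _)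
            (<-≤-trans (≤-<-trans (load-below-q l* j) (proj₂ free)) (cap-mono l* (upTo-sound q≤j)))

  assignment : ∀ P → Enough P → ∃ (Fits P)
  assignment P = go P (<-wellFounded _)
    where
    go : ∀ P → Acc _<_ (∑ (χ ∘ P)) → Enough P → ∃ (Fits P)
    go P (acc smaller) enough with argmin {_≲_ = flip F._≤_} (flip Finₚ.≤-total) (flip Finₚ.≤-trans) P cls
    ... | inj₁ none = (λ _ → l₀) , λ l j → ≤-trans (nothing-loaded l j) z≤n
      where
      nothing-loaded : ∀ l j → load (λ _ → l₀) P l j ≤ 0
      nothing-loaded l j = begin
        load (λ _ → l₀) P l j  ≡⟨ sum-cong-≗ (λ i → cong (λ b → χ (b ∧ upTo j i) * δ l₀ l) (none i)) ⟩
        ∑ {n} (λ _ → 0)        ≡⟨ sum-replicate-zero n ⟩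
        0                      ∎
        where open ≤-Reasoning
    ... | inj₂ (q , q∈P , q-greatest) = f (proj₁ rec) (proj₂ rec) , f-fits (proj₁ rec) (proj₂ rec)
      where
      open Extend enough q q∈P q-greatest
      rec = go P′ (smaller fewer) enough′

somePlayer : ∀ {n} → SimpleGame n → Fin n
somePlayer {zero}  G = ⊥-elim (∅-losing G (N-winning G))
somePlayer {suc n} G = zero

module Nakamura {n t r : ℕ} (G : SimpleGame n) (cls : Fin n → Fin t)
  (desirable : ∀ i j → cls i F.≤ cls j → Desirable G i j) (m : Fin r → Vec ℕ t)
  (m-shiftMinimal : ∀ u → ShiftMinimalWinning G cls u ⇔ (∃ λ i → m i ≡ u)) where
  open Classes cls
  open Shift G cls desirable
  open ShiftMinimal G cls m m-shiftMinimal

  o : Vec ℕ t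
  o = prefixSums (classSizes G cls)

  p : Fin r → Vec ℕ t
  p i = prefixSums (m i)

  gap : Fin t → Fin r → ℕ
  gap j i = lookup o j ∸ lookup (p i) j

  o-count : ∀ j → lookup o j ≡ countUpTo everyone j
  o-count j = trans (prefixSums-coalVec G Subset.⊤ j)
                    (sum-cong-≗ λ i → cong (λ b → χ (b ∧ upTo j i)) (lookup-replicate i true))

  o∸count : ∀ S j → lookup o j ∸ countUpTo (lookup S) j ≡ missingUpTo S j
  o∸count S j = begin
    lookup o j ∸ #S                   ≡⟨ cong (_∸ #S) (o-count j) ⟩
    countUpTo everyone j ∸ #S         ≡⟨ cong (_∸ #S) (countUpTo-complement (lookup S) j) ⟩
    #S + missingUpTo S j ∸ #S         ≡⟨ m+n∸m≡n #S _ ⟩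
    missingUpTo S j                   ∎
    where
    open ≡-Reasoning
    #S = countUpTo (lookup S) j

  m-winning : ∀ i → WinningVector G cls (m i)
  m-winning i = proj₁ (Equivalence.from (m-shiftMinimal (m i)) (i , refl))

  minimalCoalition : Fin r → Subset n
  minimalCoalition i = proj₁ (m-winning i)

  minimalCoalition-winning : ∀ i → W G (minimalCoalition i)
  minimalCoalition-winning i = proj₂ (proj₂ (m-winning i))

  gap-missing : ∀ j i → gap j i ≡ missingUpTo (minimalCoalition i) j
  gap-missing j i = trans (cong (lookup o j ∸_) p-count) (o∸count (minimalCoalition i) j)
    where
    p-count : lookup (p i) j ≡ countUpTo (lookup (minimalCoalition i)) j
    p-count = trans (cong (λ v → lookup (prefixSums v) j) (sym (proj₁ (proj₂ (m-winning i)))))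
                    (prefixSums-coalVec G (minimalCoalition i) j)

  typeCounts : ∀ Ss → All (W G) Ss →
    ∃ λ x → ∑ x ≡ length Ss × (∀ j → totalMissingUpTo Ss j ≤ ∑ (λ i → gap j i * x i))
  typeCounts [] [] = (λ _ → 0) , sum-replicate-zero r , λ _ → z≤n
  typeCounts (S ∷ Ss) (S-winning ∷ Ss-winning) = x , ∑x , covers
    where
    rec = typeCounts Ss Ss-winning
    x′ = proj₁ rec
    below = winning⇒shiftMinimalBelow S S-winning
    a = proj₁ below

    x : Fin r → ℕ
    x i = δ a i + x′ i

    ∑x : ∑ x ≡ suc (length Ss)
    ∑x = trans (∑-distrib-+ (δ a) x′) (cong₂ _+_ (∑-δ a) (proj₁ (proj₂ rec)))

    S-gap : ∀ j → missingUpTo S j ≤ gap j a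
    S-gap j = begin
      missingUpTo S j                      ≡⟨ o∸count S j ⟨
      lookup o j ∸ countUpTo (lookup S) j  ≤⟨ ∸-monoʳ-≤ (lookup o j) pa≤S ⟩
      gap j a                              ∎
      where
      open ≤-Reasoning
      pa≤S = subst (lookup (p a) j ≤_) (prefixSums-coalVec G S j) (Pointwise.lookup (proj₂ below) j)

    covers : ∀ j → totalMissingUpTo (S ∷ Ss) j ≤ ∑ (λ i → gap j i * x i)
    covers j = begin
      missingUpTo S j + totalMissingUpTo Ss j
        ≤⟨ +-mono-≤ (S-gap j) (proj₂ (proj₂ rec) j) ⟩
      gap j a + ∑ (λ i → gap j i * x′ i)
        ≡⟨ cong (_+ ∑ (λ i → gap j i * x′ i)) (∑-*-δ (gap j) a) ⟨
      ∑ (λ i → gap j i * δ a i) + ∑ (λ i → gap j i * x′ i)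
        ≡⟨ ∑-distrib-+ (λ i → gap j i * δ a i) (λ i → gap j i * x′ i) ⟨
      ∑ (λ i → gap j i * δ a i + gap j i * x′ i)
        ≡⟨ sum-cong-≗ (λ i → *-distribˡ-+ (gap j i) (δ a i) (x′ i)) ⟨
      ∑ (λ i → gap j i * x i)
        ∎
      where open ≤-Reasoning

  family⇒feasible : ∀ Ss → All (W G) Ss → ⋂ Ss ≡ Subset.⊥ →
    ∃ λ x → Feasible o p x × objective o p x ≡ length Ss
  family⇒feasible Ss Ss-winning ⋂Ss≡⊥ = x , feasible , trans (sum-tabulate x) ∑x
    where
    x = proj₁ (typeCounts Ss Ss-winning)
    ∑x = proj₁ (proj₂ (typeCounts Ss Ss-winning))
    feasible : Feasible o p x
    feasible j = begin
      lookup o j                                ≡⟨ o-count j ⟩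
      countUpTo everyone j                      ≡⟨ sum-cong-≗ (λ i → cong (λ b → χ (not b ∧ upTo j i)) (i∉⋂Ss i)) ⟨
      missingUpTo (⋂ Ss) j                      ≤⟨ missingUpTo-⋂ Ss j ⟩
      totalMissingUpTo Ss j                          ≤⟨ proj₂ (proj₂ (typeCounts Ss Ss-winning)) j ⟩
      ∑ (λ i → gap j i * x i)                   ≡⟨ sum-tabulate (λ i → gap j i * x i) ⟨
      Vec.sum (tabulate (λ i → gap j i * x i))  ∎
      where
      open ≤-Reasoning
      i∉⋂Ss : ∀ i → lookup (⋂ Ss) i ≡ false
      i∉⋂Ss i = trans (cong (λ S → lookup S i) ⋂Ss≡⊥) (lookup-replicate i false)

  feasible⇒family : ∀ x → Feasible o p x →
    ∃ λ Ss → length Ss ≡ objective o p x × All (W G) Ss × ⋂ Ss ≡ Subset.⊥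
  feasible⇒family x feasible = Ss , |Ss|≡∑x , tabulate⁺ C-winning , Empty-unique ⋂Ss-empty
    where
    K = ∑ x

    T : Fin K → Subset n
    T l = minimalCoalition (blocks x l)

    cap : Fin K → Fin t → ℕ
    cap l = missingUpTo (T l)

    enough : ∀ j → countUpTo everyone j ≤ ∑ (λ l → cap l j)
    enough j = begin
      countUpTo everyone j                       ≡⟨ o-count j ⟨
      lookup o j                                 ≤⟨ feasible j ⟩
      Vec.sum (tabulate (λ i → gap j i * x i))   ≡⟨ sum-tabulate (λ i → gap j i * x i) ⟩
      ∑ (λ i → gap j i * x i)                    ≡⟨ sum-cong-≗ (λ i → cong (_* x i) (gap-missing j i)) ⟩
      ∑ (λ i → typeCap i * x i)                  ≡⟨ ∑-blocks x typeCap ⟨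
      ∑ (λ l → cap l j)                          ∎
      where
      open ≤-Reasoning
      typeCap : Fin r → ℕ
      typeCap i = missingUpTo (minimalCoalition i) j

    l₀ : Fin K
    l₀ = proj₁ (∑-<⇒∃< (λ _ → 0) (λ l → cap l (cls i₀)) (begin-strict
      ∑ {K} (λ _ → 0)              ≡⟨ trans (sum-replicate-zero K) (sym (sum-replicate-zero n)) ⟩
      ∑ {n} (λ _ → 0)              <⟨ ∑-mono-< i₀ (λ _ → z≤n) i₀-counted ⟩
      countUpTo everyone (cls i₀)  ≤⟨ enough (cls i₀) ⟩
      ∑ (λ l → cap l (cls i₀))     ∎))
      where
      open ≤-Reasoning
      i₀ = somePlayer G
      i₀-counted : 0 < χ (upTo (cls i₀) i₀)
      i₀-counted rewrite upTo-complete {i₀} {cls i₀} Finₚ.≤-refl = s≤s z≤n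

    open Assignment cls cap (λ l → countUpTo-mono (not ∘ lookup (T l))) l₀
    assigned = assignment everyone enough
    f = proj₁ assigned

    C : Fin K → Subset n
    C l = tabulate λ i → not (does (f i ≟ l))

    Ss = List.tabulate C

    |Ss|≡∑x : length Ss ≡ objective o p x
    |Ss|≡∑x = trans (length-tabulate C) (sym (sum-tabulate x))

    C-winning : ∀ l → W G (C l)
    C-winning l = dominated⇒winning (minimalCoalition-winning (blocks x l)) T≼C
      where
      T≼C : T l ≼ C l
      T≼C j = +-cancelʳ-≤ (cap l j) _ _ (begin
        countUpTo (lookup (T l)) j + cap l j              ≡⟨ countUpTo-complement (lookup (T l)) j ⟨
        countUpTo everyone j                              ≡⟨ load-complement f everyone l j ⟩
        countUpTo unassigned j + load f everyone l j      ≡⟨ cong (_+ load f everyone l j) unassigned-C ⟩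
        countUpTo (lookup (C l)) j + load f everyone l j  ≤⟨ +-monoʳ-≤ _ (proj₂ assigned l j) ⟩
        countUpTo (lookup (C l)) j + cap l j              ∎)
        where
        open ≤-Reasoning
        unassigned : Fin n → Bool
        unassigned i = not (does (f i ≟ l))
        unassigned-C : countUpTo unassigned j ≡ countUpTo (lookup (C l)) j
        unassigned-C = sum-cong-≗ λ i →
          cong (λ b → χ (b ∧ upTo j i)) (sym (lookup∘tabulate unassigned i))

    ⋂Ss-empty : Subset.Empty (⋂ Ss)
    ⋂Ss-empty (i , i∈⋂Ss) =
      true≢false (trans (sym ([]=⇒lookup i∈⋂Ss)) (lookup-⋂ (∈-tabulate⁺ (f i)) i∉C))
      where
      i∉C : lookup (C (f i)) i ≡ false
      i∉C = trans (lookup∘tabulate _ i) (cong not (dec-true (f i ≟ f i) refl))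

lemma7 : ∀ {n t r : ℕ} (G : SimpleGame n)
         → IsComplete G
         → (∀ i → ¬ Vetoer G i)
         → (cls : Fin n → Fin t)
         → (∀ a → ∃ λ i → cls i ≡ a)
         → (∀ i j → (cls i F.≤ cls j) ⇔ Desirable G i j)
         → (m : Fin r → Vec ℕ t)
         → Injective _≡_ _≡_ m
         → (∀ u → ShiftMinimalWinning G cls u ⇔ (∃ λ i → m i ≡ u))
         → ∀ (k : ℕ)
         → IsNakamuraNumber G k
           ⇔ IsIPOptimalValue (prefixSums (classSizes G cls)) (λ i → prefixSums (m i)) k
lemma7 G _ _ cls _ desirability m _ m-shiftMinimal k = mk⇔ nakamura⇒optimal optimal⇒nakamura
  where
  open Nakamura G cls (λ i j → Equivalence.to (desirability i j)) m m-shiftMinimal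

  nakamura⇒optimal : IsNakamuraNumber G k → IsIPOptimalValue o p k
  nakamura⇒optimal ((Ss , |Ss|≡k , Ss-winning , ⋂Ss≡⊥) , k-least) =
    let x , x-feasible , objective≡ = family⇒feasible Ss Ss-winning ⋂Ss≡⊥
    in (x , x-feasible , trans objective≡ |Ss|≡k) , λ y y-feasible →
         let Ts , |Ts|≡ , Ts-winning , ⋂Ts≡⊥ = feasible⇒family y y-feasible
         in subst (k ≤_) |Ts|≡ (k-least Ts Ts-winning ⋂Ts≡⊥)

  optimal⇒nakamura : IsIPOptimalValue o p k → IsNakamuraNumber G k
  optimal⇒nakamura ((x , x-feasible , objective≡k) , k-least) =
    let Ss , |Ss|≡ , Ss-winning , ⋂Ss≡⊥ = feasible⇒family x x-feasible
    in (Ss , trans |Ss|≡ objective≡k , Ss-winning , ⋂Ss≡⊥) , λ Ts Ts-winning ⋂Ts≡⊥ →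
         let y , y-feasible , objective≡ = family⇒feasible Ts Ts-winning ⋂Ts≡⊥
         in subst (k ≤_) objective≡ (k-least y y-feasible)
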